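{- Let $G$ be a connected graph and let $\mathrm{Forb\text{ - }con}(G)$ be the class of graphs $M$ such that no connected component of $M$ is isomorphic to $G$. For $M,N\in\mathrm{Forb\text{ - }con}(G)$ define $M\preceq N$ iff $M$ is an induced subgraph of $N$ and for every complete subgraph $C$ of $N$ that is embeddable in $G$, if $C\cap M\neq\emptyset$ then $C\cap N\subseteq M$ (i.e. $C\subseteq M$). Then $(\mathrm{Forb\text{ - }con}(G),\preceq)$ satisfies the joint embedding property: for every $M_1,M_2\in\mathrm{Forb\text{ - }con}(G)$ there are $M_3\in\mathrm{Forb\text{ - }con}(G)$ and, for $n=1,2$, isomorphisms $f_n$ from $M_n$ onto induced subgraphs $f_n[M_n]\preceq M_3$.
   Context: A graph is a structure $(V,E)$ with $E$ an irreflexive symmetric binary relation; "embeddable in $G$" means isomorphic to an induced subgraph of $G$. -}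

module Defs where

open import Data.Product using (Σ; ∃; _×_; _,_)
open import Relation.Nullary using (¬_)
open import Relation.Binary.PropositionalEquality using (_≡_; _≢_)
open import Relation.Binary.Construct.Closure.ReflexiveTransitive using (Star)

record Graph : Set₁ where
  field
    V     : Set
    E     : V → V → Set
    irrefl : ∀ x → ¬ E x x
    sym   : ∀ {x y} → E x y → E y x
open Graph public

Reach : (M : Graph) → V M → V M → Set
Reach M = Star (E M)

Connected : Graph → Set
Connected M = V M × (∀ x y → Reach M x y)

-- f is an isomorphism of G onto the induced subgraph of M on the connected
-- component of v (i.e. onto {w | w reachable from v}).
IsoOntoComponent : (G M : Graph) → V M → (V G → V M) → Set
IsoOntoComponent G M v f =
  (∀ a b → f a ≡ f b → a ≡ b)
  × (∀ a b → E G a b → E M (f a) (f b))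
  × (∀ a b → E M (f a) (f b) → E G a b)
  × (∀ a → Reach M v (f a))
  × (∀ w → Reach M v w → ∃ λ a → f a ≡ w)

ForbCon : Graph → Graph → Set
ForbCon G M = ¬ (Σ (V M) λ v → Σ (V G → V M) λ f → IsoOntoComponent G M v f)

Complete : (N : Graph) → (V N → Set) → Set
Complete N C = ∀ x y → C x → C y → x ≢ y → E N x y

EmbeddableIn : (N : Graph) → (V N → Set) → Graph → Set
EmbeddableIn N C G =
  Σ ((x : V N) → C x → V G) λ h →
    (∀ x y (p : C x) (q : C y) → h x p ≡ h y q → x ≡ y)
    × (∀ x y (p : C x) (q : C y) → E N x y → E G (h x p) (h y q))
    × (∀ x y (p : C x) (q : C y) → E G (h x p) (h y q) → E N x y)

IsEmbedding : (M N : Graph) → (V M → V N) → Set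
IsEmbedding M N f =
  (∀ a b → f a ≡ f b → a ≡ b)
  × (∀ a b → E M a b → E N (f a) (f b))
  × (∀ a b → E N (f a) (f b) → E M a b)

-- f is an embedding whose image f[M] satisfies f[M] ≼ N (relative to G):
-- every complete subgraph C of N embeddable in G that meets f[M] lies in f[M].
StrongEmbedding : (G M N : Graph) → (V M → V N) → Set₁
StrongEmbedding G M N f =
  IsEmbedding M N f
  × ((C : V N → Set) → Complete N C → EmbeddableIn N C G →
       (∃ λ a → C (f a)) → ∀ y → C y → ∃ λ a → f a ≡ y)

module Submission where

-- The disjoint union M₁ ⊕ M₂ works.  Each summand sits in it as a union of
-- connected components, so a component of M₁ ⊕ M₂ isomorphic to G is already
-- a component of M₁ or of M₂; and a clique meeting one summand cannot contain
-- a vertex of the other, as there are no edges between them.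

open import Defs
open import Data.Product using (Σ; ∃; _×_; _,_; proj₁; proj₂)
open import Data.Sum using (_⊎_; inj₁; inj₂)
open import Data.Empty using (⊥; ⊥-elim)
open import Relation.Nullary using (¬_; Dec; yes; no)
open import Relation.Binary.PropositionalEquality
  using (_≡_; refl; cong; trans; subst₂) renaming (sym to ≡-sym)
open import Relation.Binary.Construct.Closure.ReflexiveTransitive using (ε; _◅_; gmap)

module _ (M₁ M₂ : Graph) where

  private
    _~_ : V M₁ ⊎ V M₂ → V M₁ ⊎ V M₂ → Set
    inj₁ x ~ inj₁ y = E M₁ x y
    inj₂ x ~ inj₂ y = E M₂ x y
    _      ~ _      = ⊥

    ~-irrefl : ∀ x → ¬ (x ~ x)
    ~-irrefl (inj₁ x) = irrefl M₁ x
    ~-irrefl (inj₂ x) = irrefl M₂ x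

    ~-sym : ∀ {x y} → x ~ y → y ~ x
    ~-sym {inj₁ _} {inj₁ _} e = Graph.sym M₁ e
    ~-sym {inj₂ _} {inj₂ _} e = Graph.sym M₂ e

  _⊕_ : Graph
  _⊕_ = record { V = V M₁ ⊎ V M₂ ; E = _~_ ; irrefl = ~-irrefl ; sym = λ {x} {y} → ~-sym {x} {y} }

Image : {A B : Set} → (A → B) → B → Set
Image ι y = ∃ λ a → ι a ≡ y

-- ι[M] is a union of connected components of N.
NeighbourClosed : (M N : Graph) → (V M → V N) → Set
NeighbourClosed M N ι = ∀ a y → E N (ι a) y → Image ι y

module _ {M N : Graph} {ι : V M → V N}
         (embedding : IsEmbedding M N ι) (closed : NeighbourClosed M N ι) where

  private
    ι-injective = proj₁ embedding
    ι-preserves = proj₁ (proj₂ embedding)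
    ι-reflects  = proj₂ (proj₂ embedding)

  reach-image : ∀ {a b} → Reach M a b → Reach N (ι a) (ι b)
  reach-image = gmap ι (λ {a} {b} → ι-preserves a b)

  reach-lift : ∀ {a y} → Reach N (ι a) y → Σ (V M) λ b → ι b ≡ y × Reach M a b
  reach-lift ε = _ , refl , ε
  reach-lift {a} (e ◅ p) with closed a _ e
  ... | b , refl with reach-lift p
  ...   | c , ιc≡y , q = c , ιc≡y , (ι-reflects a b e ◅ q)

  component-pullback : ∀ {G v f} → IsoOntoComponent G N (ι v) f →
    Σ (V G → V M) λ f′ → IsoOntoComponent G M v f′
  component-pullback {G} {v} {f} (f-injective , f-preserves , f-reflects , f-reach , f-onto) =
    f′ , f′-injective , f′-preserves , f′-reflects , f′-reach , f′-onto
    where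
    f′ : V G → V M
    f′ a = proj₁ (reach-lift (f-reach a))

    ι∘f′≡f : ∀ a → ι (f′ a) ≡ f a
    ι∘f′≡f a = proj₁ (proj₂ (reach-lift (f-reach a)))

    f′-injective : ∀ a b → f′ a ≡ f′ b → a ≡ b
    f′-injective a b eq = f-injective a b (trans (≡-sym (ι∘f′≡f a)) (trans (cong ι eq) (ι∘f′≡f b)))

    f′-preserves : ∀ a b → E G a b → E M (f′ a) (f′ b)
    f′-preserves a b e =
      ι-reflects _ _ (subst₂ (E N) (≡-sym (ι∘f′≡f a)) (≡-sym (ι∘f′≡f b)) (f-preserves a b e))

    f′-reflects : ∀ a b → E M (f′ a) (f′ b) → E G a b
    f′-reflects a b e = f-reflects a b (subst₂ (E N) (ι∘f′≡f a) (ι∘f′≡f b) (ι-preserves _ _ e))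

    f′-reach : ∀ a → Reach M v (f′ a)
    f′-reach a = proj₂ (proj₂ (reach-lift (f-reach a)))

    f′-onto : ∀ w → Reach M v w → ∃ λ a → f′ a ≡ w
    f′-onto w p with f-onto (ι w) (reach-image p)
    ... | a , fa≡ιw = a , ι-injective _ _ (trans (ι∘f′≡f a) fa≡ιw)

  -- Deciding membership in the image replaces the case split y ≡ ι a, which
  -- need not be decidable in N.
  strongEmbedding : (G : Graph) → (∀ y → Dec (Image ι y)) → StrongEmbedding G M N ι
  strongEmbedding G image? = embedding , clique-inside
    where
    clique-inside : (C : V N → Set) → Complete N C → EmbeddableIn N C G →
      (∃ λ a → C (ι a)) → ∀ y → C y → Image ι y
    clique-inside C complete _ (a , Cιa) y Cy with image? y
    ... | yes y∈ι = y∈ι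
    ... | no  y∉ι = ⊥-elim (y∉ι (closed a y (complete (ι a) y Cιa Cy (λ ιa≡y → y∉ι (a , ιa≡y)))))

module _ (M₁ M₂ : Graph) where

  inj₁-isEmbedding : IsEmbedding M₁ (M₁ ⊕ M₂) inj₁
  inj₁-isEmbedding = (λ { _ _ refl → refl }) , (λ _ _ e → e) , (λ _ _ e → e)

  inj₂-isEmbedding : IsEmbedding M₂ (M₁ ⊕ M₂) inj₂
  inj₂-isEmbedding = (λ { _ _ refl → refl }) , (λ _ _ e → e) , (λ _ _ e → e)

  inj₁-neighbourClosed : NeighbourClosed M₁ (M₁ ⊕ M₂) inj₁
  inj₁-neighbourClosed _ (inj₁ b) _ = b , refl

  inj₂-neighbourClosed : NeighbourClosed M₂ (M₁ ⊕ M₂) inj₂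
  inj₂-neighbourClosed _ (inj₂ b) _ = b , refl

  inj₁-image? : ∀ y → Dec (Image {V M₁} {V M₁ ⊎ V M₂} inj₁ y)
  inj₁-image? (inj₁ b) = yes (b , refl)
  inj₁-image? (inj₂ b) = no λ ()

  inj₂-image? : ∀ y → Dec (Image {V M₂} {V M₁ ⊎ V M₂} inj₂ y)
  inj₂-image? (inj₁ b) = no λ ()
  inj₂-image? (inj₂ b) = yes (b , refl)

  forbCon-⊕ : (G : Graph) → ForbCon G M₁ → ForbCon G M₂ → ForbCon G (M₁ ⊕ M₂)
  forbCon-⊕ G F₁ _ (inj₁ v , f , iso) =
    F₁ (v , component-pullback {M₁} {M₁ ⊕ M₂} inj₁-isEmbedding inj₁-neighbourClosed {G} {v} {f} iso)
  forbCon-⊕ G _ F₂ (inj₂ v , f , iso) =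
    F₂ (v , component-pullback {M₂} {M₁ ⊕ M₂} inj₂-isEmbedding inj₂-neighbourClosed {G} {v} {f} iso)

  inj₁-strongEmbedding : (G : Graph) → StrongEmbedding G M₁ (M₁ ⊕ M₂) inj₁
  inj₁-strongEmbedding G =
    strongEmbedding {M₁} {M₁ ⊕ M₂} inj₁-isEmbedding inj₁-neighbourClosed G inj₁-image?

  inj₂-strongEmbedding : (G : Graph) → StrongEmbedding G M₂ (M₁ ⊕ M₂) inj₂
  inj₂-strongEmbedding G =
    strongEmbedding {M₂} {M₁ ⊕ M₂} inj₂-isEmbedding inj₂-neighbourClosed G inj₂-image?

mainTheorem6 : (G : Graph) → Connected G →
    (M₁ M₂ : Graph) → ForbCon G M₁ → ForbCon G M₂ →
    Σ Graph λ M₃ → ForbCon G M₃ ×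
      (Σ (V M₁ → V M₃) λ f₁ → StrongEmbedding G M₁ M₃ f₁) ×
      (Σ (V M₂ → V M₃) λ f₂ → StrongEmbedding G M₂ M₃ f₂)
mainTheorem6 G _ M₁ M₂ F₁ F₂ =
  M₁ ⊕ M₂ , forbCon-⊕ M₁ M₂ G F₁ F₂ ,
  (inj₁ , inj₁-strongEmbedding M₁ M₂ G) ,
  (inj₂ , inj₂-strongEmbedding M₁ M₂ G)
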